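{- Let $G$ be a finite group and $H$ a non-trivial normal subgroup of $G$. If either $|H|$ or $|G/H|$ is odd, then $H$ is a $(\kappa,\tau)$-regular set of $G$ for every pair of integers $\kappa$ and $\tau$ satisfying $0\leq\kappa\leq|H|-1$, $1\leq\tau\leq|H|$ and $\gcd(2,|H|-1)\mid\kappa$.
   Context: All graphs are finite, undirected and simple. For a finite group $G$ and an inverse-closed subset $X\subseteq G\setminus\{1\}$, the Cayley graph $\mathrm{Cay}(G,X)$ has vertex set $G$ and edge set $\{\{g,gx\}: g\in G, x\in X\}$. For nonnegative integers $\kappa,\tau$, a subset $R$ of the vertex set of a graph $\Gamma$ is a $(\kappa,\tau)$-regular set of $\Gamma$ if every vertex in $R$ is adjacent to exactly $\kappa$ vertices of $R$ and every vertex outside $R$ is adjacent to exactly $\tau$ vertices of $R$. A subset $R\subseteq G$ is a $(\kappa,\tau)$-regular set of $G$ if there is a Cayley graph $\Gamma$ on $G$ such that $R$ is a $(\kappa,\tau)$-regular set of $\Gamma$. -}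

module Defs where

open import Data.Nat using (ℕ; zero; suc)
open import Data.Nat.DivMod using (_/_)
open import Data.Nat.Divisibility using (_∣_)
open import Data.Fin using (Fin)
open import Data.Fin.Subset using (Subset; _∈_; _∉_; ∣_∣)
open import Data.Fin.Subset.Properties using (_∈?_)
open import Data.Bool using (_∧_)
open import Data.Vec using (tabulate)
open import Data.Product using (Σ; _×_; ∃)
open import Relation.Nullary using (¬_; does)
open import Relation.Binary.PropositionalEquality using (_≡_; _≢_)

-- A finite group of order n, with carrier Fin n (every finite group is
-- isomorphic to one of this form).
record FinGroup (n : ℕ) : Set where
  infixl 7 _·_
  field
    _·_   : Fin n → Fin n → Fin n
    e     : Fin n
    inv   : Fin n → Fin n
    assoc : ∀ x y z → (x · y) · z ≡ x · (y · z)
    idˡ   : ∀ x → e · x ≡ x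
    idʳ   : ∀ x → x · e ≡ x
    invˡ  : ∀ x → inv x · x ≡ e
    invʳ  : ∀ x → x · inv x ≡ e

module _ {n : ℕ} (G : FinGroup n) where
  open FinGroup G

  record IsNormalSubgroup (H : Subset n) : Set where
    field
      e∈H    : e ∈ H
      ·-closed : ∀ {x y} → x ∈ H → y ∈ H → x · y ∈ H
      inv-closed : ∀ {x} → x ∈ H → inv x ∈ H
      conj-closed : ∀ g {h} → h ∈ H → (g · h) · inv g ∈ H

  NonTrivial : Subset n → Set
  NonTrivial H = Σ (Fin n) λ h → h ∈ H × h ≢ e

  IsConnectionSet : Subset n → Set
  IsConnectionSet X = e ∉ X × (∀ {x} → x ∈ X → inv x ∈ X)

  -- In Cay(G,X), the neighbours of g are the vertices g x (x ∈ X), i.e. the h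
  -- with g⁻¹ h ∈ X.  This is the set of neighbours of g lying in R.
  neighboursIn : Subset n → Subset n → Fin n → Subset n
  neighboursIn X R g = tabulate λ h → does (h ∈? R) ∧ does (inv g · h ∈? X)

  IsRegularSetOfCay : Subset n → ℕ → ℕ → Subset n → Set
  IsRegularSetOfCay X κ τ R =
    (∀ g → g ∈ R → ∣ neighboursIn X R g ∣ ≡ κ) ×
    (∀ g → g ∉ R → ∣ neighboursIn X R g ∣ ≡ τ)

  IsRegularSetOfGroup : ℕ → ℕ → Subset n → Set
  IsRegularSetOfGroup κ τ R =
    Σ (Subset n) λ X → IsConnectionSet X × IsRegularSetOfCay X κ τ R

Odd : ℕ → Set
Odd m = ¬ (2 ∣ m)

-- |G/H| = |G| / |H| (Lagrange); the value at |H| = 0 is irrelevant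
-- (subgroups are non-empty).
quotientOrder : ℕ → ℕ → ℕ
quotientOrder n zero    = 0
quotientOrder n (suc k) = n / suc k

-- Since H is normal, the neighbours in H of a vertex g of Cay(G, X) correspond to X ∩ g⁻¹H, so it
-- suffices to find an inverse-closed X ⊆ G ∖ {e} meeting H in κ elements and every other coset in
-- τ elements. Inversion maps aH onto a⁻¹H. When aH ≠ a⁻¹H, take any τ elements of one of the two
-- cosets and their inverses in the other. On H ∖ {e}, and on a coset with aH = a⁻¹H, one needs an
-- inversion-invariant subset of prescribed size; as inversion is an involution, an invariant set Q
-- has an invariant subset of size t whenever t ≤ |Q| and t is even or |Q| is odd. For H ∖ {e} this
-- is the gcd condition. A coset aH = a⁻¹H ≠ H makes |G/H| even, since left multiplication by a then
-- pairs off the cosets; so in that case |H| is odd by hypothesis.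

module Submission where

open import Defs
open import Algebra.Bundles using (Group)
open import Data.Bool using (Bool; true; false; _∧_; _∨_; not; if_then_else_)
open import Data.Bool.Properties
  using (⇔→≡; ¬-not; ∧-zeroʳ; ∧-identityʳ; ∧-conicalˡ; ∧-conicalʳ; ∨-comm; ∨-idem; not-involutive)
open import Data.Empty using (⊥-elim)
open import Data.Fin using (Fin; zero; suc; _≟_)
open import Data.Fin.Permutation using (Permutation′; permutation; _⟨$⟩ʳ_)
open import Data.Fin.Properties using (_<?_; <-cmp; <-irrefl)
open import Data.Fin.Subset using (Subset; _∈_; _∉_; ∣_∣)
open import Data.Fin.Subset.Properties using (_∈?_)
open import Data.Maybe using (Maybe; just; nothing)
import Data.Maybe as Maybe
open import Data.Maybe.Properties using (just-injective)
open import Data.Nat using (ℕ; zero; suc; _+_; _*_; _∸_; _≤_; _<_; z≤n; s≤s; s≤s⁻¹)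
open import Data.Nat.Divisibility
  using (_∣_; _∣?_; _∣0; ∣-refl; ∣-trans; ∣m+n∣m⇒∣n; ∣m∣n⇒∣m+n; ∣1⇒≡1; m*n∣o⇒m∣o/n; *-monoʳ-∣)
open import Data.Nat.GCD using (gcd; gcd-greatest)
open import Data.Nat.Induction using (<-rec)
open import Data.Nat.Properties
  using (+-0-commutativeMonoid; +-comm; +-suc; +-identityʳ; ≤-trans; ≤-<-trans; <⇒≤; ≤∧≢⇒<;
         m≤n+m; m<n+m; 1+n≢n; n≢0⇒n>0)
  renaming (_≟_ to _≟ℕ_)
open import Algebra.Properties.CommutativeMonoid.Sum +-0-commutativeMonoid using (sum; sum-permute)
open import Data.Product using (Σ-syntax; ∃; _×_; _,_; proj₁; proj₂)
open import Data.Sum using (_⊎_; inj₁; inj₂; [_,_]′)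
import Data.Sum as Sum
open import Data.Vec using (lookup; tabulate)
import Data.Vec as Vec
open import Data.Vec.Functional using (_∷_)
open import Data.Vec.Properties using ([]=⇒lookup; lookup⇒[]=; lookup∘tabulate)
open import Function using (_∘_; id)
open import Function.Bundles using (mk⇔)
open import Level using (0ℓ)
open import Relation.Binary using (IsEquivalence; tri<; tri≈; tri>)
open import Relation.Binary.PropositionalEquality
  using (_≡_; _≢_; _≗_; refl; sym; trans; cong; cong₂; subst; isEquivalence; module ≡-Reasoning)
open import Relation.Nullary using (Dec; does; yes; no; contradiction)
open import Relation.Nullary.Decidable using (dec-true; dec-false)

-- Counting subsets of Fin n given by Boolean predicates

module _ {n : ℕ} where

  infixr 7 _∩_
  infixr 6 _∪_ _─_
  infix 4 _⊆_

  _∩_ _∪_ _─_ : (P Q : Fin n → Bool) → Fin n → Bool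
  (P ∩ Q) x = P x ∧ Q x
  (P ∪ Q) x = P x ∨ Q x
  (P ─ Q) x = P x ∧ not (Q x)

  _⊆_ : (P Q : Fin n → Bool) → Set
  P ⊆ Q = ∀ {x} → P x ≡ true → Q x ≡ true

  ⁅_⁆ : Fin n → Fin n → Bool
  ⁅ x ⁆ y = does (y ≟ x)

count : ∀ {n} → (Fin n → Bool) → ℕ
count {zero}  P = 0
count {suc n} P = (if P zero then 1 else 0) + count (P ∘ suc)

count-cong : ∀ {n} {P Q : Fin n → Bool} → P ≗ Q → count P ≡ count Q
count-cong {zero}  P≗Q = refl
count-cong {suc n} P≗Q = cong₂ _+_ (cong (λ b → if b then 1 else 0) (P≗Q zero)) (count-cong (P≗Q ∘ suc))

count-permute : ∀ {n} (P : Fin n → Bool) (π : Permutation′ n) → count (P ∘ (π ⟨$⟩ʳ_)) ≡ count P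
count-permute P π = begin
  count (P ∘ (π ⟨$⟩ʳ_))                   ≡⟨ count-sum (P ∘ (π ⟨$⟩ʳ_)) ⟩
  sum ((λ x → if P x then 1 else 0) ∘ (π ⟨$⟩ʳ_)) ≡⟨ sum-permute _ π ⟨
  sum (λ x → if P x then 1 else 0)          ≡⟨ count-sum P ⟨
  count P                                  ∎
  where
  open ≡-Reasoning
  count-sum : ∀ {m} (Q : Fin m → Bool) → count Q ≡ sum (λ x → if Q x then 1 else 0)
  count-sum {zero}  Q = refl
  count-sum {suc m} Q = cong ((if Q zero then 1 else 0) +_) (count-sum (Q ∘ suc))

count-split : ∀ {n} (P A : Fin n → Bool) → count P ≡ count (P ∩ A) + count (P ─ A)
count-split {zero}  P A = refl
count-split {suc n} P A with P zero | A zero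
... | true  | true  = cong suc (count-split (P ∘ suc) (A ∘ suc))
... | true  | false = trans (cong suc (count-split (P ∘ suc) (A ∘ suc))) (sym (+-suc _ _))
... | false | _     = count-split (P ∘ suc) (A ∘ suc)

count-all : ∀ n → count {n} (λ _ → true) ≡ n
count-all zero    = refl
count-all (suc n) = cong suc (count-all n)

count-pos : ∀ {n} {P : Fin n → Bool} {x} → P x ≡ true → 0 < count P
count-pos {P = P} {zero}  Px rewrite Px = s≤s z≤n
count-pos {P = P} {suc x} Px = ≤-trans (count-pos {P = P ∘ suc} Px) (m≤n+m _ _)

count-witness : ∀ {n} (P : Fin n → Bool) → 0 < count P → ∃ λ x → P x ≡ true
count-witness {suc n} P pos with P zero in Pzero
... | true  = zero , Pzero
... | false = let x , Px = count-witness (P ∘ suc) pos in suc x , Px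

count-none : ∀ {n} (P : Fin n → Bool) → (∀ x → P x ≡ false) → count P ≡ 0
count-none {zero}  P none = refl
count-none {suc n} P none rewrite none zero = count-none (P ∘ suc) (none ∘ suc)

count-⁅⁆ : ∀ {n} (x : Fin n) → count ⁅ x ⁆ ≡ 1
count-⁅⁆ {suc n} zero = cong suc (count-none (⁅_⁆ {suc n} zero ∘ suc) (λ _ → refl))
count-⁅⁆ (suc x) = count-⁅⁆ x

module _ {n : ℕ} {S Q : Fin n → Bool} where

  ∩-⊆ : S ⊆ Q → Q ∩ S ≗ S
  ∩-⊆ S⊆Q x with S x in Sx
  ... | true  = cong (_∧ true) (S⊆Q Sx)
  ... | false = ∧-zeroʳ (Q x)

  count-∩-⊆ : S ⊆ Q → count (Q ∩ S) ≡ count S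
  count-∩-⊆ = count-cong ∘ ∩-⊆

  count-⊆ : S ⊆ Q → count Q ≡ count S + count (Q ─ S)
  count-⊆ S⊆Q = trans (count-split Q S) (cong (_+ count (Q ─ S)) (count-∩-⊆ S⊆Q))

count-∩-cong : ∀ {n} {C P Q : Fin n → Bool} → (∀ x → C x ≡ true → P x ≡ Q x) →
               count (C ∩ P) ≡ count (C ∩ Q)
count-∩-cong {C = C} {P} {Q} P≡Q = count-cong on-C
  where
  on-C : ∀ x → C x ∧ P x ≡ C x ∧ Q x
  on-C x with C x in Cx
  ... | true  = P≡Q x Cx
  ... | false = refl

⊆⇒false : ∀ {n} {S Q : Fin n → Bool} {x} → S ⊆ Q → Q x ≡ false → S x ≡ false
⊆⇒false {S = S} {x = x} S⊆Q Qx with S x in Sx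
... | true  = trans (sym (S⊆Q Sx)) Qx
... | false = refl

count-∪ : ∀ {n} {A B : Fin n → Bool} → (∀ x → A x ≡ true → B x ≡ false) →
          count (A ∪ B) ≡ count A + count B
count-∪ {A = A} {B} disjoint =
  trans (count-split (A ∪ B) A) (cong₂ _+_ (count-cong on-A) (count-cong off-A))
  where
  on-A : (A ∪ B) ∩ A ≗ A
  on-A x with A x
  ... | true  = refl
  ... | false = ∧-zeroʳ (B x)
  off-A : (A ∪ B) ─ A ≗ B
  off-A x with A x in Ax
  ... | true  = sym (disjoint x Ax)
  ... | false = ∧-identityʳ (B x)

∷-⊆ : ∀ {n} {b} {S : Fin n → Bool} {Q : Fin (suc n) → Bool} →
      (b ≡ true → Q zero ≡ true) → S ⊆ Q ∘ suc → (b ∷ S) ⊆ Q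
∷-⊆ b⇒Q S⊆Q {zero}  = b⇒Q
∷-⊆ b⇒Q S⊆Q {suc x} = S⊆Q

subset-of-size : ∀ {n} (Q : Fin n → Bool) {t} → t ≤ count Q →
                 Σ[ S ∈ (Fin n → Bool) ] S ⊆ Q × count S ≡ t
subset-of-size {zero}  Q z≤n = Q , id , refl
subset-of-size {suc n} Q {t} t≤ with Q zero in Qzero | t
... | false | t     = let S , S⊆Q , |S| = subset-of-size (Q ∘ suc) t≤ in
                      (false ∷ S) , ∷-⊆ {b = false} {Q = Q} (λ ()) S⊆Q , |S|
... | true  | zero  = let S , S⊆Q , |S| = subset-of-size (Q ∘ suc) z≤n in
                      (false ∷ S) , ∷-⊆ {b = false} {Q = Q} (λ ()) S⊆Q , |S|
... | true  | suc t = let S , S⊆Q , |S| = subset-of-size (Q ∘ suc) (s≤s⁻¹ t≤) in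
                      (true ∷ S) , ∷-⊆ {b = true} {Q = Q} (λ _ → Qzero) S⊆Q , cong suc |S|

∣∣≡count : ∀ {n} (p : Subset n) → ∣ p ∣ ≡ count (lookup p)
∣∣≡count Vec.[]           = refl
∣∣≡count (true  Vec.∷ p) = cong suc (∣∣≡count p)
∣∣≡count (false Vec.∷ p) = ∣∣≡count p

∣tabulate∣≡count : ∀ {n} (f : Fin n → Bool) → ∣ tabulate f ∣ ≡ count f
∣tabulate∣≡count f = trans (∣∣≡count (tabulate f)) (count-cong (lookup∘tabulate f))

does-∈? : ∀ {n} (x : Fin n) (p : Subset n) → does (x ∈? p) ≡ lookup p x
does-∈? zero    (true  Vec.∷ p) = refl
does-∈? zero    (false Vec.∷ p) = refl
does-∈? (suc x) (b     Vec.∷ p) = does-∈? x p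

∈-tabulate⁻ : ∀ {n} {f : Fin n → Bool} {x} → x ∈ tabulate f → f x ≡ true
∈-tabulate⁻ {f = f} {x} x∈ = trans (sym (lookup∘tabulate f x)) ([]=⇒lookup x∈)

∈-tabulate⁺ : ∀ {n} {f : Fin n → Bool} {x} → f x ≡ true → x ∈ tabulate f
∈-tabulate⁺ {f = f} {x} fx = lookup⇒[]= x (tabulate f) (trans (lookup∘tabulate f x) fx)

2∣2+ : ∀ {m} → 2 ∣ 2 + m → 2 ∣ m
2∣2+ d = ∣m+n∣m⇒∣n d ∣-refl

odd-2+ : ∀ {m} → Odd (2 + m) → Odd m
odd-2+ odd d = odd (∣m∣n⇒∣m+n ∣-refl d)

even-or-odd : ∀ m → (2 ∣ m) ⊎ (2 ∣ suc m)
even-or-odd zero    = inj₁ (2 ∣0)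
even-or-odd (suc m) = [ inj₂ ∘ ∣m∣n⇒∣m+n ∣-refl , inj₁ ]′ (even-or-odd m)

odd-suc⇒even : ∀ {m} → Odd (suc m) → 2 ∣ m
odd-suc⇒even {m} odd = [ id , ⊥-elim ∘ odd ]′ (even-or-odd m)

odd⇒pos : ∀ {m} → Odd m → 0 < m
odd⇒pos {zero}  odd = ⊥-elim (odd (2 ∣0))
odd⇒pos {suc m} odd = s≤s z≤n

gcd[2,m]∣k⇒even⊎odd : ∀ {m k} → gcd 2 m ∣ k → 2 ∣ k ⊎ Odd m
gcd[2,m]∣k⇒even⊎odd {m} gcd∣k with 2 ∣? m
... | yes 2∣m = inj₁ (∣-trans (gcd-greatest ∣-refl 2∣m) gcd∣k)
... | no  odd = inj₂ odd

-- Invariant subsets of an involution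

module Involution {n : ℕ} (ι : Fin n → Fin n) (ι-involutive : ∀ x → ι (ι x) ≡ x) where

  Invariant : (Fin n → Bool) → Set
  Invariant P = ∀ x → P (ι x) ≡ P x

  ∪-invariant : ∀ {P Q} → Invariant P → Invariant Q → Invariant (P ∪ Q)
  ∪-invariant P-inv Q-inv x = cong₂ _∨_ (P-inv x) (Q-inv x)

  ─-invariant : ∀ {P Q} → Invariant P → Invariant Q → Invariant (P ─ Q)
  ─-invariant P-inv Q-inv x = cong₂ (λ p q → p ∧ not q) (P-inv x) (Q-inv x)

  orbit : Fin n → Fin n → Bool
  orbit x = ⁅ x ⁆ ∪ ⁅ ι x ⁆

  ι≟ : ∀ y x → does (ι y ≟ x) ≡ does (y ≟ ι x)
  ι≟ y x with y ≟ ι x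
  ... | yes refl = dec-true (ι (ι x) ≟ x) (ι-involutive x)
  ... | no  y≢ιx = dec-false (ι y ≟ x) λ ιy≡x → y≢ιx (trans (sym (ι-involutive y)) (cong ι ιy≡x))

  orbit-invariant : ∀ x → Invariant (orbit x)
  orbit-invariant x y = begin
    does (ι y ≟ x) ∨ does (ι y ≟ ι x)      ≡⟨ cong₂ _∨_ (ι≟ y x) (ι≟ y (ι x)) ⟩
    does (y ≟ ι x) ∨ does (y ≟ ι (ι x))    ≡⟨ cong (λ z → does (y ≟ ι x) ∨ does (y ≟ z)) (ι-involutive x) ⟩
    does (y ≟ ι x) ∨ does (y ≟ x)          ≡⟨ ∨-comm (does (y ≟ ι x)) (does (y ≟ x)) ⟩
    does (y ≟ x) ∨ does (y ≟ ι x)          ∎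
    where open ≡-Reasoning

  orbit-⊆ : ∀ {Q x} → Invariant Q → Q x ≡ true → orbit x ⊆ Q
  orbit-⊆ {Q} {x} Q-inv Qx {y} y∈ with y ≟ x | y ≟ ι x
  ... | yes refl | _        = Qx
  ... | no _     | yes refl = trans (Q-inv x) Qx

  count-orbit-fixed : ∀ {x} → ι x ≡ x → count (orbit x) ≡ 1
  count-orbit-fixed {x} ιx≡x = trans (count-cong same) (count-⁅⁆ x)
    where
    same : orbit x ≗ ⁅ x ⁆
    same y rewrite ιx≡x = ∨-idem _

  count-orbit-moved : ∀ {x} → ι x ≢ x → count (orbit x) ≡ 2
  count-orbit-moved {x} ιx≢x =
    trans (count-∪ {A = ⁅ x ⁆} {B = ⁅ ι x ⁆} disjoint) (cong₂ _+_ (count-⁅⁆ x) (count-⁅⁆ (ι x)))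
    where
    disjoint : ∀ y → ⁅ x ⁆ y ≡ true → ⁅ ι x ⁆ y ≡ false
    disjoint y y≡x with y ≟ x
    ... | yes refl = dec-false (y ≟ ι y) (ιx≢x ∘ sym)

  InvariantSubsetOfSize : (Fin n → Bool) → ℕ → Set
  InvariantSubsetOfSize Q t = Σ[ S ∈ (Fin n → Bool) ] S ⊆ Q × Invariant S × count S ≡ t

  shrink : ∀ {Q O t} → InvariantSubsetOfSize (Q ─ O) t → InvariantSubsetOfSize Q t
  shrink {Q} (S , S⊆Q─O , S-inv , |S|) = S , (λ {x} Sx → ∧-conicalˡ (Q x) _ (S⊆Q─O Sx)) , S-inv , |S|

  extend : ∀ {Q O t} → O ⊆ Q → Invariant O → InvariantSubsetOfSize (Q ─ O) t →
           InvariantSubsetOfSize Q (t + count O)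
  extend {Q} {O} O⊆Q O-inv (S , S⊆Q─O , S-inv , |S|) =
    S ∪ O , S∪O⊆Q , ∪-invariant S-inv O-inv , trans (count-∪ disjoint) (cong (_+ count O) |S|)
    where
    disjoint : ∀ x → S x ≡ true → O x ≡ false
    disjoint x Sx = trans (sym (not-involutive (O x))) (cong not (∧-conicalʳ (Q x) _ (S⊆Q─O Sx)))
    S∪O⊆Q : S ∪ O ⊆ Q
    S∪O⊆Q {x} S∪Ox with S x in Sx
    ... | true  = ∧-conicalˡ (Q x) _ (S⊆Q─O Sx)
    ... | false = O⊆Q S∪Ox

  module SplitOff {Q : Fin n → Bool} (Q-inv : Invariant Q) {x : Fin n} (Qx : Q x ≡ true) where

    Rest : Fin n → Bool
    Rest = Q ─ orbit x

    Rest-invariant : Invariant Rest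
    Rest-invariant = ─-invariant Q-inv (orbit-invariant x)

    count-split-off : count Q ≡ count (orbit x) + count Rest
    count-split-off = count-⊆ {S = orbit x} {Q = Q} (orbit-⊆ Q-inv Qx)

    Rest-smaller : count Rest < count Q
    Rest-smaller = subst (count Rest <_) (sym count-split-off)
      (m<n+m (count Rest) (count-pos {P = orbit x} {x} x∈orbit))
      where
      x∈orbit : orbit x x ≡ true
      x∈orbit = cong (_∨ does (x ≟ ι x)) (dec-true (x ≟ x) refl)

    count-split-off-fixed : ι x ≡ x → count Q ≡ 1 + count Rest
    count-split-off-fixed ιx≡x = trans count-split-off (cong (_+ count Rest) (count-orbit-fixed ιx≡x))

    count-split-off-moved : ι x ≢ x → count Q ≡ 2 + count Rest
    count-split-off-moved ιx≢x = trans count-split-off (cong (_+ count Rest) (count-orbit-moved ιx≢x))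

    module _ (IH : ∀ {u} → u ≤ count Rest → 2 ∣ u ⊎ Odd (count Rest) →
                       InvariantSubsetOfSize Rest u) where

      add-orbit : ∀ {u} → u ≤ count Rest → 2 ∣ u ⊎ Odd (count Rest) →
                  InvariantSubsetOfSize Q (u + count (orbit x))
      add-orbit u≤ u-parity = extend (orbit-⊆ Q-inv Qx) (orbit-invariant x) (IH u≤ u-parity)

      from-fixed-point : ι x ≡ x → ∀ {t} → t < count Q → InvariantSubsetOfSize Q t
      from-fixed-point ιx≡x {zero} _ = shrink (IH z≤n (inj₁ (2 ∣0)))
      from-fixed-point ιx≡x {suc t} t< with 2 ∣? suc t
      ... | yes even = shrink (IH (s≤s⁻¹ (subst (_ <_) (count-split-off-fixed ιx≡x) t<)) (inj₁ even))
      ... | no  odd  =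
        subst (InvariantSubsetOfSize Q) (trans (cong (t +_) (count-orbit-fixed ιx≡x)) (+-comm t 1))
          (add-orbit (s≤s⁻¹ (<⇒≤ (subst (_ <_) (count-split-off-fixed ιx≡x) t<)))
                     (inj₁ (odd-suc⇒even odd)))

      from-moved : ι x ≢ x → ∀ {t} → t < count Q → 2 ∣ t ⊎ Odd (count Q) → InvariantSubsetOfSize Q t
      from-moved ιx≢x {zero} _ _ = shrink (IH z≤n (inj₁ (2 ∣0)))
      from-moved ιx≢x {suc zero} _ (inj₁ 2∣1) = ⊥-elim (1+n≢n (∣1⇒≡1 2∣1))
      from-moved ιx≢x {suc zero} _ (inj₂ odd) = shrink (IH (odd⇒pos odd-Rest) (inj₂ odd-Rest))
        where
        odd-Rest : Odd (count Rest)
        odd-Rest = odd-2+ (subst Odd (count-split-off-moved ιx≢x) odd)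
      from-moved ιx≢x {suc (suc t)} t< parity =
        subst (InvariantSubsetOfSize Q) (trans (cong (t +_) (count-orbit-moved ιx≢x)) (+-comm t 2))
          (add-orbit (s≤s⁻¹ (s≤s⁻¹ (<⇒≤ (subst (_ <_) (count-split-off-moved ιx≢x) t<))))
                     (Sum.map 2∣2+ (odd-2+ ∘ subst Odd (count-split-off-moved ιx≢x)) parity))

  -- Strong induction on |Q|: for t = |Q| take Q itself, otherwise split off one orbit O and put it
  -- into the subset exactly when that preserves the parity condition (|O| = 2 ≤ t, or |O| = 1 and t odd).
  invariant-subset-of-size : ∀ Q {t} → Invariant Q → t ≤ count Q → 2 ∣ t ⊎ Odd (count Q) →
                             InvariantSubsetOfSize Q t
  invariant-subset-of-size Q = <-rec Goal step (count Q) Q refl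
    where
    Goal : ℕ → Set
    Goal m = ∀ Q {t} → count Q ≡ m → Invariant Q → t ≤ count Q → 2 ∣ t ⊎ Odd (count Q) →
             InvariantSubsetOfSize Q t
    step : ∀ m → (∀ {k} → k < m → Goal k) → Goal m
    step _ rec Q {t} refl Q-inv t≤ parity with t ≟ℕ count Q
    ... | yes refl = Q , id , Q-inv , refl
    ... | no  t≢   = split-off (count-witness Q (≤-<-trans z≤n t<))
      where
      t< : t < count Q
      t< = ≤∧≢⇒< t≤ t≢
      split-off : (∃ λ x → Q x ≡ true) → InvariantSubsetOfSize Q t
      split-off (x , Qx) = by-orbit (ι x ≟ x)
        where
        open SplitOff Q-inv Qx
        IH : ∀ {u} → u ≤ count Rest → 2 ∣ u ⊎ Odd (count Rest) → InvariantSubsetOfSize Rest u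
        IH = rec Rest-smaller Rest refl Rest-invariant
        by-orbit : Dec (ι x ≡ x) → InvariantSubsetOfSize Q t
        by-orbit (yes ιx≡x) = from-fixed-point IH ιx≡x t<
        by-orbit (no  ιx≢x) = from-moved IH ιx≢x t< parity

-- Equivalence classes with canonical representatives

find : ∀ {n} → (Fin n → Bool) → Maybe (Fin n)
find {zero}  P = nothing
find {suc n} P = if P zero then just zero else Maybe.map suc (find (P ∘ suc))

find-cong : ∀ {n} {P Q : Fin n → Bool} → P ≗ Q → find P ≡ find Q
find-cong {zero}  P≗Q = refl
find-cong {suc n} {P} {Q} P≗Q =
  cong₂ (λ b m → if b then just zero else Maybe.map suc m) (P≗Q zero) (find-cong (P≗Q ∘ suc))

find-sound : ∀ {n} (P : Fin n → Bool) {y} → find P ≡ just y → P y ≡ true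
find-sound {suc n} P found with P zero in Pzero | find (P ∘ suc) in found′
find-sound {suc n} P refl | true  | _      = Pzero
find-sound {suc n} P refl | false | just z = find-sound (P ∘ suc) found′

find-complete : ∀ {n} (P : Fin n → Bool) {x} → P x ≡ true → ∃ λ y → find P ≡ just y
find-complete {suc n} P {x} Px with P zero in Pzero | x
... | true  | _     = zero , refl
... | false | zero  with () ← trans (sym Px) Pzero
... | false | suc x with find-complete (P ∘ suc) Px
...   | y , found = suc y , cong (Maybe.map suc) found

<?-flip : ∀ {n} {x y : Fin n} → x ≢ y → does (y <? x) ≡ not (does (x <? y))
<?-flip {x = x} {y} x≢y with <-cmp x y
... | tri< x<y _ y≮x = trans (dec-false (y <? x) y≮x) (cong not (sym (dec-true (x <? y) x<y)))
... | tri≈ _ x≡y _   = ⊥-elim (x≢y x≡y)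
... | tri> x≮y _ y<x = trans (dec-true (y <? x) y<x) (cong not (sym (dec-false (x <? y) x≮y)))

if-<?-swap : ∀ {a} {A : Set a} {n} {x y : Fin n} {u v : A} → x ≢ y →
             (if does (x <? y) then u else v) ≡ (if does (y <? x) then v else u)
if-<?-swap {x = x} {y} x≢y rewrite <?-flip x≢y with does (x <? y)
... | true  = refl
... | false = refl

module Partition {n : ℕ} (C : Fin n → Fin n → Bool)
                 (C-equivalence : IsEquivalence (λ x y → C x y ≡ true)) where

  infix 4 _∼_
  _∼_ : Fin n → Fin n → Set
  x ∼ y = C x y ≡ true

  open IsEquivalence C-equivalence public
    using () renaming (refl to ∼-refl; sym to ∼-sym; trans to ∼-trans)

  class-cong : ∀ {x y} → x ∼ y → C x ≗ C y
  class-cong x∼y z = ⇔→≡ (mk⇔ (∼-trans (∼-sym x∼y)) (∼-trans x∼y))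

  class-respects : ∀ x {y z} → y ∼ z → C x y ≡ C x z
  class-respects x y∼z = ⇔→≡ (mk⇔ (λ x∼y → ∼-trans x∼y y∼z) (λ x∼z → ∼-trans x∼z (∼-sym y∼z)))

  rep : Fin n → Fin n
  rep x = proj₁ (find-complete (C x) ∼-refl)

  find-class : ∀ x → find (C x) ≡ just (rep x)
  find-class x = proj₂ (find-complete (C x) ∼-refl)

  rep-∼ : ∀ x → x ∼ rep x
  rep-∼ x = find-sound (C x) (find-class x)

  rep-cong : ∀ {x y} → x ∼ y → rep x ≡ rep y
  rep-cong {x} {y} x∼y = just-injective (begin
    just (rep x)  ≡⟨ find-class x ⟨
    find (C x)    ≡⟨ find-cong (class-cong x∼y) ⟩
    find (C y)    ≡⟨ find-class y ⟩
    just (rep y)  ∎)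
    where open ≡-Reasoning

  rep-≡⇒∼ : ∀ {x y} → rep x ≡ rep y → x ∼ y
  rep-≡⇒∼ {x} {y} rx≡ry = ∼-trans (rep-∼ x) (subst (_∼ y) (sym rx≡ry) (∼-sym (rep-∼ y)))

  class-size-divides : ∀ {h} → (∀ x → count (C x) ≡ h) →
                   ∀ P → (∀ {x y} → x ∼ y → P x ≡ P y) → h ∣ count P
  class-size-divides {h} |C| P = <-rec Goal step (count P) P refl
    where
    Goal : ℕ → Set
    Goal m = ∀ P → count P ≡ m → (∀ {x y} → x ∼ y → P x ≡ P y) → h ∣ count P
    step : ∀ m → (∀ {k} → k < m → Goal k) → Goal m
    step _ rec P refl P-resp with count P ≟ℕ 0
    ... | yes |P|≡0 = subst (h ∣_) (sym |P|≡0) (h ∣0)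
    ... | no  |P|≢0 = remove-class (count-witness P (n≢0⇒n>0 |P|≢0))
      where
      remove-class : (∃ λ x → P x ≡ true) → h ∣ count P
      remove-class (x , Px) =
        subst (h ∣_) (sym |P|) (∣m∣n⇒∣m+n ∣-refl (rec smaller (P ─ C x) refl rest-respects))
        where
        C⊆P : C x ⊆ P
        C⊆P x∼y = trans (sym (P-resp x∼y)) Px
        split : count P ≡ count (C x) + count (P ─ C x)
        split = count-⊆ {S = C x} {Q = P} C⊆P
        |P| : count P ≡ h + count (P ─ C x)
        |P| = trans split (cong (_+ count (P ─ C x)) (|C| x))
        smaller : count (P ─ C x) < count P
        smaller = subst (count (P ─ C x) <_) (sym split) (m<n+m _ (count-pos {P = C x} ∼-refl))
        rest-respects : ∀ {y z} → y ∼ z → (P ─ C x) y ≡ (P ─ C x) z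
        rest-respects y∼z = cong₂ (λ p c → p ∧ not c) (P-resp y∼z) (class-respects x y∼z)

-- Finite groups and cosets of a normal subgroup

asGroup : ∀ {n} → FinGroup n → Group 0ℓ 0ℓ
asGroup G = record
  { isGroup = record
    { isMonoid = record
      { isSemigroup = record
        { isMagma = record { isEquivalence = isEquivalence ; ∙-cong = cong₂ _·_ }
        ; assoc = assoc }
      ; identity = idˡ , idʳ }
    ; inverse = invˡ , invʳ
    ; ⁻¹-cong = cong inv } }
  where open FinGroup G

even-quotient : ∀ {m h} → 2 * h ∣ m → 2 ∣ quotientOrder m h
even-quotient {h = zero}  _     = 2 ∣0
even-quotient {h = suc h} 2h∣m = m*n∣o⇒m∣o/n 2 (suc h) 2h∣m

module Cosets {n : ℕ} (G : FinGroup n) (H : Subset n) (H-normal : IsNormalSubgroup G H) where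

  open FinGroup G
  open IsNormalSubgroup H-normal
  open import Algebra.Properties.Group (asGroup G)
    using (⁻¹-involutive; ⁻¹-anti-homo-∙; ε⁻¹≈ε; \\-leftDividesˡ; \\-leftDividesʳ; //-rightDividesʳ)
  open Involution inv ⁻¹-involutive public

  inH : Fin n → Bool
  inH = lookup H

  ∈⇒inH : ∀ {x} → x ∈ H → inH x ≡ true
  ∈⇒inH = []=⇒lookup

  inH⇒∈ : ∀ {x} → inH x ≡ true → x ∈ H
  inH⇒∈ {x} = lookup⇒[]= x H

  inH-e : inH e ≡ true
  inH-e = ∈⇒inH e∈H

  inH-· : ∀ {x y} → inH x ≡ true → inH y ≡ true → inH (x · y) ≡ true
  inH-· x∈H y∈H = ∈⇒inH (·-closed (inH⇒∈ x∈H) (inH⇒∈ y∈H))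

  inH-inv : ∀ x → inH (inv x) ≡ inH x
  inH-inv x = ⇔→≡ (mk⇔ (λ x⁻¹∈H → subst (λ z → inH z ≡ true) (⁻¹-involutive x) (closed x⁻¹∈H)) closed)
    where
    closed : ∀ {y} → inH y ≡ true → inH (inv y) ≡ true
    closed y∈H = ∈⇒inH (inv-closed (inH⇒∈ y∈H))

  inH-conj : ∀ g h → inH ((g · h) · inv g) ≡ inH h
  inH-conj g h =
    ⇔→≡ (mk⇔ (λ ghg⁻¹∈H → subst (λ z → inH z ≡ true) unconj (closed (inv g) ghg⁻¹∈H)) (closed g))
    where
    closed : ∀ g {h} → inH h ≡ true → inH ((g · h) · inv g) ≡ true
    closed g h∈H = ∈⇒inH (conj-closed g (inH⇒∈ h∈H))
    unconj : (inv g · ((g · h) · inv g)) · inv (inv g) ≡ h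
    unconj = begin
      (inv g · ((g · h) · inv g)) · inv (inv g)
        ≡⟨ cong (λ z → (inv g · z) · inv (inv g)) (assoc g h (inv g)) ⟩
      (inv g · (g · (h · inv g))) · inv (inv g)
        ≡⟨ cong (_· inv (inv g)) (\\-leftDividesʳ g (h · inv g)) ⟩
      (h · inv g) · inv (inv g)
        ≡⟨ //-rightDividesʳ (inv g) h ⟩
      h ∎
      where open ≡-Reasoning

  inH-comm : ∀ x y → inH (x · y) ≡ inH (y · x)
  inH-comm x y = begin
    inH (x · y)                  ≡⟨ cong (λ z → inH (x · z)) (//-rightDividesʳ x y) ⟨
    inH (x · ((y · x) · inv x))  ≡⟨ cong inH (assoc x (y · x) (inv x)) ⟨
    inH ((x · (y · x)) · inv x)  ≡⟨ inH-conj x (y · x) ⟩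
    inH (y · x)                  ∎
    where open ≡-Reasoning

  coset : Fin n → Fin n → Bool
  coset a x = inH (inv a · x)

  coset-isEquivalence : IsEquivalence (λ a x → coset a x ≡ true)
  coset-isEquivalence = record
    { refl  = λ {a} → subst (λ z → inH z ≡ true) (sym (invˡ a)) inH-e
    ; sym   = λ {a} {x} a∼x → subst (λ z → inH z ≡ true) (inv-swap a x) (trans (inH-inv (inv a · x)) a∼x)
    ; trans = λ {a} {x} {y} a∼x x∼y → subst (λ z → inH z ≡ true) (cancel a x y) (inH-· a∼x x∼y)
    }
    where
    inv-swap : ∀ a x → inv (inv a · x) ≡ inv x · a
    inv-swap a x = trans (⁻¹-anti-homo-∙ (inv a) x) (cong (inv x ·_) (⁻¹-involutive a))
    cancel : ∀ a x y → (inv a · x) · (inv x · y) ≡ inv a · y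
    cancel a x y = trans (assoc (inv a) x (inv x · y)) (cong (inv a ·_) (\\-leftDividesˡ x y))

  open Partition coset coset-isEquivalence public

  translation : Fin n → Permutation′ n
  translation g = permutation (g ·_) (inv g ·_) (\\-leftDividesˡ g) (\\-leftDividesʳ g)

  |H|≡count : ∣ H ∣ ≡ count inH
  |H|≡count = ∣∣≡count H

  count-coset : ∀ a → count (coset a) ≡ ∣ H ∣
  count-coset a = begin
    count (coset a)          ≡⟨ count-permute (coset a) (translation a) ⟨
    count (coset a ∘ (a ·_)) ≡⟨ count-cong (cong inH ∘ \\-leftDividesʳ a) ⟩
    count inH                ≡⟨ |H|≡count ⟨
    ∣ H ∣                    ∎
    where open ≡-Reasoning

  member-∼ : ∀ {a x} → a ∼ x → inH a ≡ true → inH x ≡ true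
  member-∼ {a} {x} a∼x a∈H = subst (λ z → inH z ≡ true) (\\-leftDividesˡ a x) (inH-· a∈H a∼x)

  inH-∼ : ∀ {a x} → a ∼ x → inH x ≡ inH a
  inH-∼ a∼x = ⇔→≡ (mk⇔ (member-∼ (∼-sym a∼x)) (member-∼ a∼x))

  coset-of-member : ∀ {a} → inH a ≡ true → coset a ≗ inH
  coset-of-member a∈H x = ⇔→≡ (mk⇔ (λ a∼x → member-∼ a∼x a∈H) (inH-· (trans (inH-inv _) a∈H)))

  coset-inverse : ∀ a x → coset a (inv x) ≡ coset (inv a) x
  coset-inverse a x = begin
    inH (inv a · inv x)    ≡⟨ cong inH (⁻¹-anti-homo-∙ x a) ⟨
    inH (inv (x · a))      ≡⟨ inH-inv (x · a) ⟩
    inH (x · a)            ≡⟨ inH-comm x a ⟩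
    inH (a · x)            ≡⟨ cong (λ z → inH (z · x)) (⁻¹-involutive a) ⟨
    inH (inv (inv a) · x)  ∎
    where open ≡-Reasoning

  ∼-inverse : ∀ {a x} → a ∼ x → inv a ∼ inv x
  ∼-inverse {a} {x} a∼x =
    trans (coset-inverse (inv a) x) (trans (cong (λ z → coset z x) (⁻¹-involutive a)) a∼x)

  translate-∼ : ∀ g {x y} → x ∼ y → g · x ∼ g · y
  translate-∼ g {x} {y} x∼y = subst (λ z → inH z ≡ true) (sym cancel) x∼y
    where
    cancel : inv (g · x) · (g · y) ≡ inv x · y
    cancel = begin
      inv (g · x) · (g · y)      ≡⟨ cong (_· (g · y)) (⁻¹-anti-homo-∙ g x) ⟩
      (inv x · inv g) · (g · y)  ≡⟨ assoc (inv x) (inv g) (g · y) ⟩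
      inv x · (inv g · (g · y))  ≡⟨ cong (inv x ·_) (\\-leftDividesʳ g y) ⟩
      inv x · y                  ∎
      where open ≡-Reasoning

  coset-translate : ∀ g x → coset x (g · x) ≡ inH g
  coset-translate g x = trans (inH-comm (inv x) (g · x)) (cong inH (//-rightDividesʳ x g))

  -- x ↦ a x permutes the cosets without fixed points and squares to the identity on them, so the
  -- union E of the cosets xH whose representative precedes that of axH contains exactly half of G.
  index-even : ∀ {a} → inH a ≡ false → a ∼ inv a → 2 ∣ quotientOrder n (∣ H ∣)
  index-even {a} a∉H a∼a⁻¹ =
    even-quotient {h = ∣ H ∣}
      (subst ((2 * ∣ H ∣) ∣_) (sym n≡2|E|) (*-monoʳ-∣ 2 (class-size-divides count-coset E E-resp)))
    where
    E : Fin n → Bool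
    E x = does (rep x <? rep (a · x))

    E-resp : ∀ {x y} → x ∼ y → E x ≡ E y
    E-resp x∼y = cong₂ (λ r s → does (r <? s)) (rep-cong x∼y) (rep-cong (translate-∼ a x∼y))

    a²∈H : inH (a · a) ≡ true
    a²∈H = trans (sym (inH-inv (a · a))) (trans (cong inH (⁻¹-anti-homo-∙ a a)) a∼a⁻¹)

    moves : ∀ x → rep x ≢ rep (a · x)
    moves x rx≡rax with () ← trans (sym a∉H) (trans (sym (coset-translate a x)) (rep-≡⇒∼ rx≡rax))

    returns : ∀ x → rep (a · (a · x)) ≡ rep x
    returns x = rep-cong (∼-sym (subst (x ∼_) (assoc a a x) (trans (coset-translate (a · a) x) a²∈H)))

    E-flip : ∀ x → E (a · x) ≡ not (E x)
    E-flip x = trans (cong (λ r → does (rep (a · x) <? r)) (returns x)) (<?-flip (moves x))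

    n≡2|E| : n ≡ 2 * count E
    n≡2|E| = begin
      n                                ≡⟨ count-all n ⟨
      count {n} (λ _ → true)           ≡⟨ count-split (λ _ → true) E ⟩
      count E + count (not ∘ E)        ≡⟨ cong (count E +_) (count-cong E-flip) ⟨
      count E + count (E ∘ (a ·_))     ≡⟨ cong (count E +_) (count-permute E (translation a)) ⟩
      count E + count E                ≡⟨ cong (count E +_) (+-identityʳ (count E)) ⟨
      2 * count E                      ∎
      where open ≡-Reasoning

  count-neighbours : ∀ X g → ∣ neighboursIn G X H g ∣ ≡ count (coset (inv g) ∩ lookup X)
  count-neighbours X g = begin
    ∣ neighboursIn G X H g ∣
      ≡⟨ ∣tabulate∣≡count (λ h → does (h ∈? H) ∧ does (inv g · h ∈? X)) ⟩
    count (λ h → does (h ∈? H) ∧ does (inv g · h ∈? X))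
      ≡⟨ count-cong (λ h → cong₂ _∧_ (does-∈? h H) (does-∈? (inv g · h) X)) ⟩
    count (λ h → inH h ∧ lookup X (inv g · h))
      ≡⟨ count-permute _ (translation g) ⟨
    count (λ x → inH (g · x) ∧ lookup X (inv g · (g · x)))
      ≡⟨ count-cong (λ x → cong₂ (λ y z → inH (y · x) ∧ lookup X z) (sym (⁻¹-involutive g)) (\\-leftDividesʳ g x)) ⟩
    count (coset (inv g) ∩ lookup X) ∎
    where open ≡-Reasoning

  H* : Fin n → Bool
  H* = inH ─ orbit e

  |H|∸1≡count-H* : ∣ H ∣ ∸ 1 ≡ count H*
  |H|∸1≡count-H* = cong (_∸ 1) (trans |H|≡count (SplitOff.count-split-off-fixed inH-inv inH-e ε⁻¹≈ε))

  coset-invariant : ∀ {a} → a ∼ inv a → Invariant (coset a)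
  coset-invariant a∼a⁻¹ x = trans (coset-inverse _ x) (sym (class-cong a∼a⁻¹ x))

  self-inverse-rep : ∀ {x} → x ∼ inv x → rep x ∼ inv (rep x)
  self-inverse-rep {x} x∼x⁻¹ = ∼-trans (∼-sym (rep-∼ x)) (∼-trans x∼x⁻¹ (∼-inverse (rep-∼ x)))

  module RegularConnectionSet {κ τ : ℕ} (κ≤ : κ ≤ ∣ H ∣ ∸ 1) (κ-parity : 2 ∣ κ ⊎ Odd (∣ H ∣ ∸ 1))
           (τ≤ : τ ≤ ∣ H ∣) (odd-if-self-inverse : ∀ {a} → inH a ≡ false → a ∼ inv a → Odd ∣ H ∣) where

    K-spec : InvariantSubsetOfSize H* κ
    K-spec = invariant-subset-of-size H* (─-invariant inH-inv (orbit-invariant e))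
               (subst (κ ≤_) |H|∸1≡count-H* κ≤) (Sum.map₂ (subst Odd |H|∸1≡count-H*) κ-parity)

    K : Fin n → Bool
    K = proj₁ K-spec

    K⊆H* : K ⊆ H*
    K⊆H* = proj₁ (proj₂ K-spec)

    K-invariant : Invariant K
    K-invariant = proj₁ (proj₂ (proj₂ K-spec))

    |K| : count K ≡ κ
    |K| = proj₂ (proj₂ (proj₂ K-spec))

    CosetPart : Fin n → Set
    CosetPart a = Σ[ S ∈ (Fin n → Bool) ]
                  S ⊆ coset a × count S ≡ τ × (inH a ≡ false → a ∼ inv a → Invariant S)

    τ≤coset : ∀ a → τ ≤ count (coset a)
    τ≤coset a = subst (τ ≤_) (sym (count-coset a)) τ≤

    coset-part : ∀ a → CosetPart a
    coset-part a with inH a in a∉H | coset a (inv a) in a∼a⁻¹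
    ... | false | true  =
      let S , S⊆ , S-inv , |S| = invariant-subset-of-size (coset a) (coset-invariant a∼a⁻¹) (τ≤coset a)
                                   (inj₂ (subst Odd (sym (count-coset a)) (odd-if-self-inverse a∉H a∼a⁻¹)))
      in S , S⊆ , |S| , λ _ _ → S-inv
    ... | true  | _     = let S , S⊆ , |S| = subset-of-size (coset a) (τ≤coset a) in S , S⊆ , |S| , λ ()
    ... | false | false = let S , S⊆ , |S| = subset-of-size (coset a) (τ≤coset a) in S , S⊆ , |S| , λ _ ()

    part : Fin n → Fin n → Bool
    part a = proj₁ (coset-part a)

    part⊆coset : ∀ a → part a ⊆ coset a
    part⊆coset a = proj₁ (proj₂ (coset-part a))

    |part| : ∀ a → count (part a) ≡ τ
    |part| a = proj₁ (proj₂ (proj₂ (coset-part a)))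

    -- Of the two cosets xH and x⁻¹H, X takes its prescribed part in the one with the smaller
    -- representative and mirrors it in the other; when they coincide, that part is inverse-closed.
    outside : Fin n → Bool
    outside x = if does (rep (inv x) <? rep x) then part (rep (inv x)) (inv x) else part (rep x) x

    connection : Fin n → Bool
    connection x = if inH x then K x else outside x

    part-invariant : ∀ {x} → inH x ≡ false → x ∼ inv x → Invariant (part (rep x))
    part-invariant {x} x∉H x∼x⁻¹ =
      proj₂ (proj₂ (proj₂ (coset-part (rep x)))) (trans (inH-∼ (rep-∼ x)) x∉H) (self-inverse-rep x∼x⁻¹)

    count-part : ∀ {a b} → a ∼ b → count (coset a ∩ part b) ≡ τ
    count-part {a} {b} a∼b = begin
      count (coset a ∩ part b)  ≡⟨ count-cong (λ x → cong (_∧ part b x) (class-cong a∼b x)) ⟩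
      count (coset b ∩ part b)  ≡⟨ count-∩-⊆ {S = part b} {Q = coset b} (part⊆coset b) ⟩
      count (part b)            ≡⟨ |part| b ⟩
      τ                         ∎
      where open ≡-Reasoning

    outside-inverse : ∀ {x} → inH x ≡ false → outside (inv x) ≡ outside x
    outside-inverse {x} x∉H = trans
      (cong (λ y → if does (rep y <? rep (inv x)) then part (rep y) y else part (rep (inv x)) (inv x))
            (⁻¹-involutive x))
      (by-reps (rep x ≟ rep (inv x)))
      where
      by-reps : Dec (rep x ≡ rep (inv x)) →
                (if does (rep x <? rep (inv x)) then part (rep x) x else part (rep (inv x)) (inv x)) ≡ outside x
      by-reps (no rx≢rx⁻¹) = if-<?-swap rx≢rx⁻¹
      by-reps (yes rx≡rx⁻¹) rewrite sym rx≡rx⁻¹ | dec-false (rep x <? rep x) (<-irrefl refl) =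
        part-invariant x∉H (rep-≡⇒∼ rx≡rx⁻¹) x

    connection-member : ∀ {x} → inH x ≡ true → connection x ≡ K x
    connection-member {x} = cong (if_then K x else outside x)

    connection-nonmember : ∀ {x} → inH x ≡ false → connection x ≡ outside x
    connection-nonmember {x} = cong (if_then K x else outside x)

    K⊆H : K ⊆ inH
    K⊆H Kx = ∧-conicalˡ _ _ (K⊆H* Kx)

    connection-e : connection e ≡ false
    connection-e = trans (connection-member inH-e) (⊆⇒false {S = K} {Q = H*} K⊆H* e∉H*)
      where
      e∉H* : H* e ≡ false
      e∉H* rewrite dec-true (e ≟ e) refl = ∧-zeroʳ (inH e)

    connection-inverse : ∀ x → connection (inv x) ≡ connection x
    connection-inverse x = by-membership (inH x) refl
      where
      by-membership : ∀ b → inH x ≡ b → connection (inv x) ≡ connection x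
      by-membership true  x∈H = trans (connection-member (trans (inH-inv x) x∈H))
                                      (trans (K-invariant x) (sym (connection-member x∈H)))
      by-membership false x∉H = trans (connection-nonmember (trans (inH-inv x) x∉H))
                                      (trans (outside-inverse x∉H) (sym (connection-nonmember x∉H)))

    count-connection-member : ∀ {a} → inH a ≡ true → count (coset a ∩ connection) ≡ κ
    count-connection-member {a} a∈H = begin
      count (coset a ∩ connection)  ≡⟨ count-cong (λ x → cong (_∧ connection x) (coset-of-member a∈H x)) ⟩
      count (inH ∩ connection)      ≡⟨ count-∩-cong {C = inH} (λ x → connection-member {x}) ⟩
      count (inH ∩ K)               ≡⟨ count-∩-⊆ {S = K} {Q = inH} K⊆H ⟩
      count K                       ≡⟨ |K| ⟩
      κ                             ∎
      where open ≡-Reasoning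

    count-connection-nonmember : ∀ {a} → inH a ≡ false → count (coset a ∩ connection) ≡ τ
    count-connection-nonmember {a} a∉H = begin
      count (coset a ∩ connection)  ≡⟨ count-∩-cong {C = coset a} on-coset ⟩
      count (coset a ∩ outside-a)   ≡⟨ by-order (does (rep (inv a) <? rep a)) ⟩
      τ                             ∎
      where
      open ≡-Reasoning
      outside-a : Fin n → Bool
      outside-a x = if does (rep (inv a) <? rep a) then part (rep (inv a)) (inv x) else part (rep a) x
      on-coset : ∀ x → a ∼ x → connection x ≡ outside-a x
      on-coset x a∼x = trans (connection-nonmember (trans (inH-∼ a∼x) a∉H))
        (cong₂ (λ r r′ → if does (r′ <? r) then part r′ (inv x) else part r x)
               (rep-cong (∼-sym a∼x)) (rep-cong (∼-sym (∼-inverse a∼x))))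
      by-order : ∀ b → count (coset a ∩ (λ x → if b then part (rep (inv a)) (inv x) else part (rep a) x)) ≡ τ
      by-order false = count-part (rep-∼ a)
      by-order true  = begin
        count (λ x → coset a x ∧ part (rep (inv a)) (inv x))
          ≡⟨ count-cong (λ x → cong (_∧ part (rep (inv a)) (inv x)) (coset-inverse′ x)) ⟩
        count ((coset (inv a) ∩ part (rep (inv a))) ∘ inv)
          ≡⟨ count-permute _ inversion ⟩
        count (coset (inv a) ∩ part (rep (inv a)))
          ≡⟨ count-part (rep-∼ (inv a)) ⟩
        τ ∎
        where
        coset-inverse′ : ∀ x → coset a x ≡ coset (inv a) (inv x)
        coset-inverse′ x = sym (trans (coset-inverse (inv a) x) (cong (λ z → coset z x) (⁻¹-involutive a)))
        inversion : Permutation′ n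
        inversion = permutation inv inv ⁻¹-involutive ⁻¹-involutive

    X : Subset n
    X = tabulate connection

    X-isConnectionSet : IsConnectionSet G X
    X-isConnectionSet = e∉X , X-inverse-closed
      where
      e∉X : e ∉ X
      e∉X e∈X with () ← trans (sym (∈-tabulate⁻ e∈X)) connection-e
      X-inverse-closed : ∀ {x} → x ∈ X → inv x ∈ X
      X-inverse-closed {x} x∈X = ∈-tabulate⁺ (trans (connection-inverse x) (∈-tabulate⁻ x∈X))

    count-neighbours-X : ∀ g → ∣ neighboursIn G X H g ∣ ≡ count (coset (inv g) ∩ connection)
    count-neighbours-X g = trans (count-neighbours X g)
      (count-cong λ x → cong (coset (inv g) x ∧_) (lookup∘tabulate connection x))

    X-isRegular : IsRegularSetOfCay G X κ τ H
    X-isRegular = (λ g g∈H → trans (count-neighbours-X g) (count-connection-member (inv∈H g∈H)))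
                , (λ g g∉H → trans (count-neighbours-X g) (count-connection-nonmember (inv∉H g∉H)))
      where
      inv∈H : ∀ {g} → g ∈ H → inH (inv g) ≡ true
      inv∈H g∈H = trans (inH-inv _) (∈⇒inH g∈H)
      inv∉H : ∀ {g} → g ∉ H → inH (inv g) ≡ false
      inv∉H {g} g∉H = trans (inH-inv g) (¬-not (g∉H ∘ inH⇒∈))

-- The construction does not need H to be non-trivial nor τ to be positive.
corollary1p2 : (n : ℕ) (G : FinGroup n) (H : Subset n) →
    IsNormalSubgroup G H → NonTrivial G H →
    Odd ∣ H ∣ ⊎ Odd (quotientOrder n ∣ H ∣) →
    (κ τ : ℕ) → κ ≤ ∣ H ∣ ∸ 1 → 1 ≤ τ → τ ≤ ∣ H ∣ →
    gcd 2 (∣ H ∣ ∸ 1) ∣ κ →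
    IsRegularSetOfGroup G κ τ H
corollary1p2 n G H H-normal _ odd-order-or-index κ τ κ≤ _ τ≤ gcd∣κ = X , X-isConnectionSet , X-isRegular
  where
  open FinGroup G using (inv)
  open Cosets G H H-normal
  odd-if-self-inverse : ∀ {a} → inH a ≡ false → a ∼ inv a → Odd ∣ H ∣
  odd-if-self-inverse a∉H a∼a⁻¹ =
    [ id , (λ odd-index → contradiction (index-even a∉H a∼a⁻¹) odd-index) ]′ odd-order-or-index
  open RegularConnectionSet κ≤ (gcd[2,m]∣k⇒even⊎odd gcd∣κ) τ≤ odd-if-self-inverse
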